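{- Let $n\geq 3$ and let $f\in F(n)$ be non-constant. Suppose that $f$ does not contain $2P_1$ and has a unique periodic configuration. Then $|\Delta^+(f)|=1$, and there exists $h\in F(n)$ with $h\sim f$ and $|\Delta^-(h)|\neq|\Delta^-(f)|$.
   Context: $F(n)$ is the set of all functions $\{0,1\}^n\to\{0,1\}^n$, written $f=(f_1,\dots,f_n)$. $e_i$ is the configuration with a $1$ exactly in component $i$; addition is componentwise mod $2$. The asynchronous graph $\mathcal{A}(f)$ is the digraph on $\{0,1\}^n$ with an arc $x\to x+e_i$ whenever $f_i(x)\neq x_i$. $f$ contains $2P_1$ if there exist configurations $x,y$ with $x,y,f(x),f(y)$ pairwise distinct. A periodic configuration is one lying on a cycle of $\mathcal{S}(f)$ (the digraph with arcs $x\to f(x)$). $\bar x$ is $x$ with all components flipped; $\Delta^+(f)=\{x: f(x)=\bar x\}$; $\Delta^-(f)$ is the set of configurations of in-degree $n$ in $\mathcal{A}(f)$. $f\sim h$ means $\mathcal{S}(f)$ and $\mathcal{S}(h)$ are isomorphic. -}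

module Defs where

open import Data.Nat using (ℕ; zero; suc)
open import Data.Bool using (Bool; true; false; not; _≟_)
open import Data.Fin using (Fin)
open import Data.Vec using (Vec; []; _∷_; lookup; updateAt)
import Data.Vec as Vec
open import Data.Vec.Properties using (≡-dec)
open import Data.List using (List; [_]; _++_; map; length; filter; allFin)
open import Data.Product using (Σ; ∃; _×_; _,_)
open import Relation.Binary.PropositionalEquality using (_≡_; _≢_)
open import Relation.Nullary using (Dec; ¬_; ¬?)
open import Function.Bundles using (_↔_; Inverse)

-- configurations {0,1}^n (true = 1)
Config : ℕ → Set
Config n = Vec Bool n

F : ℕ → Set
F n = Config n → Config n

_≟c_ : ∀ {n} (x y : Config n) → Dec (x ≡ y)
_≟c_ = ≡-dec _≟_

allConfigs : (n : ℕ) → List (Config n)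
allConfigs zero = [ [] ]
allConfigs (suc n) = map (true ∷_) (allConfigs n) ++ map (false ∷_) (allConfigs n)

flipAt : ∀ {n} → Config n → Fin n → Config n
flipAt x i = updateAt x i not

complement : ∀ {n} → Config n → Config n
complement = Vec.map not

NonConstant : ∀ {n} → F n → Set
NonConstant f = Σ _ λ x → Σ _ λ y → f x ≢ f y

Contains2P1 : ∀ {n} → F n → Set
Contains2P1 f = Σ _ λ x → Σ _ λ y →
  x ≢ y × x ≢ f x × x ≢ f y × y ≢ f x × y ≢ f y × f x ≢ f y

iter : ∀ {n} → F n → ℕ → Config n → Config n
iter f zero x = x
iter f (suc k) x = f (iter f k x)

Periodic : ∀ {n} → F n → Config n → Set
Periodic f x = Σ ℕ λ k → iter f (suc k) x ≡ x

UniquePeriodic : ∀ {n} → F n → Set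
UniquePeriodic f = Σ _ λ x → Periodic f x × (∀ y → Periodic f y → y ≡ x)

cardΔ⁺ : ∀ {n} → F n → ℕ
cardΔ⁺ {n} f = length (filter (λ x → f x ≟c complement x) (allConfigs n))

-- in-degree of x in A(f): number of i with an arc x+e_i → x,
-- i.e. f_i(x+e_i) ≠ (x+e_i)_i
inDegree : ∀ {n} → F n → Config n → ℕ
inDegree {n} f x =
  length (filter (λ i → ¬? (lookup (f (flipAt x i)) i ≟ lookup (flipAt x i) i)) (allFin n))

cardΔ⁻ : ∀ {n} → F n → ℕ
cardΔ⁻ {n} f = length (filter (λ x → Data.Nat._≟_ (inDegree f x) n) (allConfigs n))
  where import Data.Nat

-- f ∼ h : S(f) and S(h) are isomorphic digraphs
_∼_ : ∀ {n} → F n → F n → Set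
_∼_ {n} f h = Σ (Config n ↔ Config n) λ φ →
  ∀ x → Inverse.to φ (f x) ≡ h (Inverse.to φ x)

{-# OPTIONS --safe #-}
module Submission where

open import Defs
open import Data.Nat using (ℕ; _≥_)
open import Data.Product using (Σ; _×_)
open import Relation.Binary.PropositionalEquality using (_≡_; _≢_)
open import Relation.Nullary using (¬_)

-- The hypotheses force f to be a collapse: a fixed point z, a point b ≠ z with f b = z, and
-- f y = b for every other y.  Indeed the unique periodic point z is fixed, and if b = f a ≠ z,
-- then, no cycle other than z being allowed, the absence of 2P₁ sends every y ∉ {z, a, b} into
-- {a, b}; this yields f b = z and then f y = b for all y ∉ {z, b}.  For a collapse, f x = x̄
-- holds exactly for x = b if b̄ = z and for x = b̄ otherwise.  Any two collapses are conjugate by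
-- a bijection matching their pairs (z, b), so it suffices to find two collapses with different
-- |Δ⁻|: for n ≥ 3 the one with z = 1, b = 0 has both 0 and e₀ of in-degree n, while the one with
-- z = e₀, b = 0 has at most e₀, because all its images vanish outside coordinate 0.

open import Data.Nat using (zero; suc; _+_; _≤_; z≤n; s≤s; _≤?_)
import Data.Nat as ℕ
open import Data.Nat.Properties using (≤-antisym; ≤-trans; <-irrefl; ≤-refl; n≤1+n; ≤⇒≯)
open import Data.Bool using (true; false; not)
import Data.Bool as Bool
open import Data.Bool.Properties using (not-¬; ¬-not; not-involutive)
open import Data.Fin using (Fin)
import Data.Fin as Fin
open import Data.Vec using ([]; _∷_; lookup; replicate)
open import Data.Vec.Properties using (lookup∘updateAt; lookup-replicate; ∷-injectiveˡ; ∷-injectiveʳ)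
open import Data.List using ([]; _∷_; map; length; filter; allFin)
open import Data.List.Properties using (filter-all; filter-notAll; length-tabulate)
open import Data.List.Membership.Propositional using (_∈_; lose)
open import Data.List.Membership.Propositional.Properties
  using (∈-map⁺; ∈-map⁻; ∈-++⁺ˡ; ∈-++⁺ʳ; ∈-filter⁺; ∈-filter⁻; ∈-allFin; ∈-length)
open import Data.List.Relation.Unary.Any using (here; there)
import Data.List.Relation.Unary.All as All
open import Data.List.Relation.Unary.All using ([]; _∷_)
open import Data.List.Relation.Unary.AllPairs using ([]; _∷_)
open import Data.List.Relation.Unary.Unique.Propositional using (Unique)
import Data.List.Relation.Unary.Unique.Propositional.Properties as Unique
open import Data.Product using (∃; ∃₂; _,_; proj₂)
open import Data.Sum using (_⊎_; inj₁; inj₂)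
import Data.Sum as Sum
open import Data.Empty using (⊥-elim)
open import Relation.Nullary using (Dec; yes; no; ¬?; contradiction)
open import Relation.Unary using (Decidable)
open import Relation.Binary.Definitions using (DecidableEquality)
open import Relation.Binary.PropositionalEquality
  using (refl; sym; trans; cong; cong₂; subst; module ≡-Reasoning)
open import Function.Base using (_∘_)
open import Function.Bundles using (_↔_; Inverse; Injection; mk↔ₛ′)
open import Function.Construct.Composition using (_↔-∘_)
open import Function.Properties.Inverse using (↔⇒↣)
open Inverse using (to)

module _ {A : Set} where

  all≡⇒length≤1 : ∀ {c : A} {xs} → Unique xs → (∀ {x} → x ∈ xs → x ≡ c) → length xs ≤ 1
  all≡⇒length≤1 {xs = []}        _               _     = z≤n
  all≡⇒length≤1 {xs = _ ∷ []}    _               _     = ≤-refl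
  all≡⇒length≤1 {xs = _ ∷ _ ∷ _} ((x≢y ∷ _) ∷ _) all≡c =
    contradiction (trans (all≡c (here refl)) (sym (all≡c (there (here refl))))) x≢y

  distinct-∈⇒2≤length : ∀ {x y : A} {xs} → x ∈ xs → y ∈ xs → x ≢ y → 2 ≤ length xs
  distinct-∈⇒2≤length (here refl)  (here refl)  x≢y = contradiction refl x≢y
  distinct-∈⇒2≤length (here refl)  (there y∈)   _   = s≤s (∈-length y∈)
  distinct-∈⇒2≤length (there x∈)   (here refl)  _   = s≤s (∈-length x∈)
  distinct-∈⇒2≤length (there x∈)   (there y∈)   x≢y =
    ≤-trans (distinct-∈⇒2≤length x∈ y∈ x≢y) (n≤1+n _)

∈-allConfigs : ∀ {n} (x : Config n) → x ∈ allConfigs n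
∈-allConfigs []                  = here refl
∈-allConfigs {suc n} (true ∷ x)  = ∈-++⁺ˡ (∈-map⁺ (true ∷_) (∈-allConfigs x))
∈-allConfigs {suc n} (false ∷ x) =
  ∈-++⁺ʳ (map (true ∷_) (allConfigs n)) (∈-map⁺ (false ∷_) (∈-allConfigs x))

allConfigs-unique : ∀ n → Unique (allConfigs n)
allConfigs-unique zero    = [] ∷ []
allConfigs-unique (suc n) = Unique.++⁺ (Unique.map⁺ ∷-injectiveʳ (allConfigs-unique n))
                                       (Unique.map⁺ ∷-injectiveʳ (allConfigs-unique n))
                                       heads-differ
  where
  heads-differ : ∀ {v} → ¬ (v ∈ map (true ∷_) (allConfigs n) × v ∈ map (false ∷_) (allConfigs n))
  heads-differ (v∈ , w∈) with ∈-map⁻ (true ∷_) v∈ | ∈-map⁻ (false ∷_) w∈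
  ... | _ , _ , refl | _ , _ , ()

module _ {n} {P : Config n → Set} (P? : Decidable P) where

  count≤1 : ∀ {c} → (∀ x → P x → x ≡ c) → length (filter P? (allConfigs n)) ≤ 1
  count≤1 only-c = all≡⇒length≤1 (Unique.filter⁺ P? {allConfigs n} (allConfigs-unique n))
                                     (λ x∈ → only-c _ (proj₂ (∈-filter⁻ P? {xs = allConfigs n} x∈)))

  count≡1 : ∀ {c} → P c → (∀ x → P x → x ≡ c) → length (filter P? (allConfigs n)) ≡ 1
  count≡1 {c} Pc only-c = ≤-antisym (count≤1 only-c) (∈-length (∈-filter⁺ P? (∈-allConfigs c) Pc))

  2≤count : ∀ {x y} → P x → P y → x ≢ y → 2 ≤ length (filter P? (allConfigs n))
  2≤count {x} {y} Px Py = distinct-∈⇒2≤length (∈-filter⁺ P? (∈-allConfigs x) Px)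
                                                  (∈-filter⁺ P? (∈-allConfigs y) Py)

record IsCollapse {A : Set} (f : A → A) (z b : A) : Set where
  field
    z≢b     : z ≢ b
    fixes-z : f z ≡ z
    b↦z     : f b ≡ z
    rest↦b  : ∀ y → y ≢ z → y ≢ b → f y ≡ b

module _ {A : Set} (_≟_ : DecidableEquality A) where

  collapse : A → A → A → A
  collapse z b x with x ≟ z | x ≟ b
  ... | yes _ | _     = z
  ... | no _  | yes _ = z
  ... | no _  | no _  = b

  collapse-isCollapse : ∀ {z b} → z ≢ b → IsCollapse (collapse z b) z b
  collapse-isCollapse {z} {b} z≢b = record
    { z≢b = z≢b ; fixes-z = fixes-z ; b↦z = b↦z ; rest↦b = rest↦b }
    where
    fixes-z : collapse z b z ≡ z
    fixes-z with z ≟ z | z ≟ b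
    ... | yes _  | _ = refl
    ... | no z≢z | _ = contradiction refl z≢z
    b↦z : collapse z b b ≡ z
    b↦z with b ≟ z | b ≟ b
    ... | yes _ | _      = refl
    ... | no _  | yes _  = refl
    ... | no _  | no b≢b = contradiction refl b≢b
    rest↦b : ∀ y → y ≢ z → y ≢ b → collapse z b y ≡ b
    rest↦b y y≢z y≢b with y ≟ z | y ≟ b
    ... | yes y≡z | _       = contradiction y≡z y≢z
    ... | no _    | yes y≡b = contradiction y≡b y≢b
    ... | no _    | no _    = refl

  swap : A → A → A → A
  swap u v x with x ≟ u | x ≟ v
  ... | yes _ | _     = v
  ... | no _  | yes _ = u
  ... | no _  | no _  = x

  swap-fst : ∀ u v → swap u v u ≡ v
  swap-fst u v with u ≟ u | u ≟ v
  ... | yes _  | _ = refl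
  ... | no u≢u | _ = contradiction refl u≢u

  swap-snd : ∀ u v → swap u v v ≡ u
  swap-snd u v with v ≟ u | v ≟ v
  ... | yes v≡u | _      = v≡u
  ... | no _    | yes _  = refl
  ... | no _    | no v≢v = contradiction refl v≢v

  swap-other : ∀ {u v x} → x ≢ u → x ≢ v → swap u v x ≡ x
  swap-other {u} {v} {x} x≢u x≢v with x ≟ u | x ≟ v
  ... | yes x≡u | _       = contradiction x≡u x≢u
  ... | no _    | yes x≡v = contradiction x≡v x≢v
  ... | no _    | no _    = refl

  swap-involutive : ∀ u v x → swap u v (swap u v x) ≡ x
  swap-involutive u v x with x ≟ u | x ≟ v
  ... | yes refl | _        = swap-snd u v
  ... | no _     | yes refl = swap-fst u v
  ... | no x≢u   | no x≢v   = swap-other x≢u x≢v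

  transposition : A → A → A ↔ A
  transposition u v = mk↔ₛ′ (swap u v) (swap u v) (swap-involutive u v) (swap-involutive u v)

  ↔-two-transitive : ∀ {z b z′ b′} → z′ ≢ b′ → z ≢ b →
                     Σ (A ↔ A) λ φ → to φ z′ ≡ z × to φ b′ ≡ b
  ↔-two-transitive {z} {b} {z′} {b′} z′≢b′ z≢b =
    transposition w b ↔-∘ transposition z′ z , z′↦z , swap-fst w b
    where
    open ≡-Reasoning
    w : A
    w = swap z′ z b′
    z≢w : z ≢ w
    z≢w z≡w = z′≢b′ (begin
      z′                   ≡⟨ swap-snd z′ z ⟨
      swap z′ z z          ≡⟨ cong (swap z′ z) z≡w ⟩
      swap z′ z w          ≡⟨ swap-involutive z′ z b′ ⟩
      b′                   ∎)
    z′↦z : swap w b (swap z′ z z′) ≡ z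
    z′↦z = trans (cong (swap w b) (swap-fst z′ z)) (swap-other z≢w z≢b)

  module _ {f g : A → A} {z b z′ b′} (F : IsCollapse f z b) (G : IsCollapse g z′ b′)
           (φ : A ↔ A) (φz′ : to φ z′ ≡ z) (φb′ : to φ b′ ≡ b) where
    private
      module F = IsCollapse F
      module G = IsCollapse G
      open ≡-Reasoning

      φ-injective : ∀ {x y} → to φ x ≡ to φ y → x ≡ y
      φ-injective = Injection.injective (↔⇒↣ φ)

    conjugate-collapses : ∀ x → to φ (g x) ≡ f (to φ x)
    conjugate-collapses x with x ≟ z′ | x ≟ b′
    ... | yes refl | _ = begin
      to φ (g z′)  ≡⟨ cong (to φ) G.fixes-z ⟩
      to φ z′      ≡⟨ φz′ ⟩
      z            ≡⟨ F.fixes-z ⟨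
      f z          ≡⟨ cong f φz′ ⟨
      f (to φ z′)  ∎
    ... | no _ | yes refl = begin
      to φ (g b′)  ≡⟨ cong (to φ) G.b↦z ⟩
      to φ z′      ≡⟨ φz′ ⟩
      z            ≡⟨ F.b↦z ⟨
      f b          ≡⟨ cong f φb′ ⟨
      f (to φ b′)  ∎
    ... | no x≢z′ | no x≢b′ = begin
      to φ (g x)   ≡⟨ cong (to φ) (G.rest↦b x x≢z′ x≢b′) ⟩
      to φ b′      ≡⟨ φb′ ⟩
      b            ≡⟨ F.rest↦b (to φ x) (λ e → x≢z′ (φ-injective (trans e (sym φz′))))
                                        (λ e → x≢b′ (φ-injective (trans e (sym φb′)))) ⟨
      f (to φ x)   ∎

  collapse-conjugate : ∀ {f g : A → A} {z b z′ b′} → IsCollapse f z b → IsCollapse g z′ b′ →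
                       Σ (A ↔ A) λ φ → ∀ x → to φ (g x) ≡ f (to φ x)
  collapse-conjugate F G with ↔-two-transitive (IsCollapse.z≢b G) (IsCollapse.z≢b F)
  ... | φ , φz′ , φb′ = φ , conjugate-collapses F G φ φz′ φb′

iter-f : ∀ {n} (f : F n) k x → iter f k (f x) ≡ f (iter f k x)
iter-f f zero    x = refl
iter-f f (suc k) x = cong f (iter-f f k x)

periodic-f : ∀ {n} {f : F n} {x} → Periodic f x → Periodic f (f x)
periodic-f {f = f} {x} (k , fᵏ⁺¹x≡x) = k , trans (iter-f f (suc k) x) (cong f fᵏ⁺¹x≡x)

images-collide : ∀ {n} {f : F n} → ¬ Contains2P1 f → ∀ {x y} →
                 x ≢ y → x ≢ f x → y ≢ f y → y ≢ f x → x ≡ f y ⊎ f x ≡ f y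
images-collide {f = f} no2P1 {x} {y} x≢y x≢fx y≢fy y≢fx with x ≟c f y | f x ≟c f y
... | yes x≡fy | _         = inj₁ x≡fy
... | no _     | yes fx≡fy = inj₂ fx≡fy
... | no x≢fy  | no fx≢fy  = ⊥-elim (no2P1 (x , y , x≢y , x≢fx , x≢fy , y≢fx , y≢fy , fx≢fy))

module _ {n} {f : F n} {z a : Config n} (no2P1 : ¬ Contains2P1 f)
         (only-z : ∀ y → Periodic f y → y ≡ z) (fz≡z : f z ≡ z) (fa≢z : f a ≢ z) where
  private
    b : Config n
    b = f a

    fixed⇒z : ∀ {x} → f x ≡ x → x ≡ z
    fixed⇒z e = only-z _ (0 , e)

    2-periodic⇒z : ∀ {x} → f (f x) ≡ x → x ≡ z
    2-periodic⇒z e = only-z _ (1 , e)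

    3-periodic⇒z : ∀ {x} → f (f (f x)) ≡ x → x ≡ z
    3-periodic⇒z e = only-z _ (2 , e)

    moved : ∀ {x} → x ≢ z → x ≢ f x
    moved x≢z x≡fx = x≢z (fixed⇒z (sym x≡fx))

    a≢z : a ≢ z
    a≢z a≡z = fa≢z (trans (cong f a≡z) fz≡z)

    a≢b : a ≢ b
    a≢b = moved a≢z

    outside↦a-or-b : ∀ {y} → y ≢ z → y ≢ a → y ≢ b → f y ≡ a ⊎ f y ≡ b
    outside↦a-or-b y≢z y≢a y≢b =
      Sum.map sym sym (images-collide no2P1 (λ a≡y → y≢a (sym a≡y)) a≢b (moved y≢z) y≢b)

    b↦z : f b ≡ z
    b↦z with f b ≟c z
    ... | yes fb≡z = fb≡z
    ... | no fb≢z with outside↦a-or-b fb≢z (λ fb≡a → a≢z (2-periodic⇒z fb≡a))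
                                            (λ fb≡b → fa≢z (fixed⇒z fb≡b))
    ...   | inj₁ ffb≡a = contradiction (3-periodic⇒z ffb≡a) a≢z
    ...   | inj₂ ffb≡b = contradiction (2-periodic⇒z ffb≡b) fa≢z

    rest↦b : ∀ y → y ≢ z → y ≢ b → f y ≡ b
    rest↦b y y≢z y≢b with y ≟c a
    ... | yes refl = refl
    ... | no y≢a with outside↦a-or-b y≢z y≢a y≢b
    ...   | inj₂ fy≡b = fy≡b
    ...   | inj₁ fy≡a with images-collide no2P1 y≢b (moved y≢z) (moved fa≢z)
                                          (λ b≡fy → a≢b (sym (trans b≡fy fy≡a)))
    ...     | inj₁ y≡fb  = contradiction (trans y≡fb b↦z) y≢z
    ...     | inj₂ fy≡fb = contradiction (trans (sym fy≡a) (trans fy≡fb b↦z)) a≢z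

  collapse-structure : IsCollapse f z (f a)
  collapse-structure = record
    { z≢b = λ z≡b → fa≢z (sym z≡b) ; fixes-z = fz≡z ; b↦z = b↦z ; rest↦b = rest↦b }

nonConstant⇒image≢ : ∀ {n} {f : F n} → NonConstant f → ∀ z → ∃ λ a → f a ≢ z
nonConstant⇒image≢ {f = f} (x , y , fx≢fy) z with f x ≟c z
... | no fx≢z  = x , fx≢z
... | yes fx≡z = y , λ fy≡z → fx≢fy (trans fx≡z (sym fy≡z))

unique-periodic⇒collapse : ∀ {n} {f : F n} → NonConstant f → ¬ Contains2P1 f → UniquePeriodic f →
                           ∃₂ (IsCollapse f)
unique-periodic⇒collapse {f = f} nonConstant no2P1 (z , z-periodic , only-z)
  with nonConstant⇒image≢ nonConstant z
... | a , fa≢z = z , f a , collapse-structure no2P1 only-z fz≡z fa≢z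
  where
  fz≡z : f z ≡ z
  fz≡z = only-z (f z) (periodic-f {f = f} z-periodic)

complement-involutive : ∀ {n} (x : Config n) → complement (complement x) ≡ x
complement-involutive []      = refl
complement-involutive (a ∷ x) = cong₂ _∷_ (not-involutive a) (complement-involutive x)

≢complement : ∀ {n} (x : Config (suc n)) → x ≢ complement x
≢complement (a ∷ _) x≡x̄ = not-¬ refl (∷-injectiveˡ x≡x̄)

complement-swap : ∀ {n} {x y : Config n} → y ≡ complement x → x ≡ complement y
complement-swap {x = x} refl = sym (complement-involutive x)

module _ {m} {f : F (suc m)} {z b} (C : IsCollapse f z b) where
  private
    module C = IsCollapse C

    self-dual⇒≢z : ∀ {x} → f x ≡ complement x → x ≢ z
    self-dual⇒≢z {x} fx≡x̄ refl = ≢complement x (trans (sym C.fixes-z) fx≡x̄)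

    self-dual⇒b-or-b̄ : ∀ {x} → f x ≡ complement x → x ≡ b ⊎ x ≡ complement b
    self-dual⇒b-or-b̄ {x} fx≡x̄ with x ≟c b
    ... | yes x≡b = inj₁ x≡b
    ... | no x≢b  = inj₂ (complement-swap (trans (sym (C.rest↦b x (self-dual⇒≢z fx≡x̄) x≢b)) fx≡x̄))

  cardΔ⁺-collapse : cardΔ⁺ f ≡ 1
  cardΔ⁺-collapse with complement b ≟c z
  ... | yes b̄≡z = count≡1 (λ x → f x ≟c complement x) (trans C.b↦z (sym b̄≡z)) only-b
    where
    only-b : ∀ x → f x ≡ complement x → x ≡ b
    only-b x fx≡x̄ with self-dual⇒b-or-b̄ fx≡x̄
    ... | inj₁ x≡b = x≡b
    ... | inj₂ x≡b̄ = contradiction (trans x≡b̄ b̄≡z) (self-dual⇒≢z fx≡x̄)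
  ... | no b̄≢z = count≡1 (λ x → f x ≟c complement x) fb̄≡b̄̄ only-b̄
    where
    fb̄≡b̄̄ : f (complement b) ≡ complement (complement b)
    fb̄≡b̄̄ = trans (C.rest↦b _ b̄≢z (≢complement b ∘ sym)) (sym (complement-involutive b))
    only-b̄ : ∀ x → f x ≡ complement x → x ≡ complement b
    only-b̄ x fx≡x̄ with self-dual⇒b-or-b̄ fx≡x̄
    ... | inj₁ refl = contradiction (trans (sym C.b↦z) fx≡x̄) (b̄≢z ∘ sym)
    ... | inj₂ x≡b̄ = x≡b̄

FullInDegree : ∀ {n} → F n → Config n → Set
FullInDegree h x = ∀ i → lookup (h (flipAt x i)) i ≡ lookup x i

lookup-flipAt : ∀ {n} (x : Config n) i → lookup (flipAt x i) i ≡ not (lookup x i)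
lookup-flipAt x i = lookup∘updateAt i x

flipAt≢ : ∀ {n} (x : Config n) i → flipAt x i ≢ x
flipAt≢ x i x+eᵢ≡x = not-¬ refl (trans (sym (cong (λ v → lookup v i) x+eᵢ≡x)) (lookup-flipAt x i))

module _ {n} (h : F n) (x : Config n) where
  private
    Arc : Fin n → Set
    Arc i = lookup (h (flipAt x i)) i ≢ lookup (flipAt x i) i

    arc? : Decidable Arc
    arc? i = ¬? (lookup (h (flipAt x i)) i Bool.≟ lookup (flipAt x i) i)

    arc⇒ : ∀ {i} → Arc i → lookup (h (flipAt x i)) i ≡ lookup x i
    arc⇒ {i} arc = trans (¬-not (λ e → arc (trans e (sym (lookup-flipAt x i))))) (not-involutive _)

    arc⇐ : ∀ {i} → lookup (h (flipAt x i)) i ≡ lookup x i → Arc i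
    arc⇐ {i} hᵢ≡xᵢ e = not-¬ hᵢ≡xᵢ (trans e (lookup-flipAt x i))

    length-allFin : length (allFin n) ≡ n
    length-allFin = length-tabulate (λ i → i)

  inDegree≡n⇒full : inDegree h x ≡ n → FullInDegree h x
  inDegree≡n⇒full deg≡n i with arc? i
  ... | yes arc  = arc⇒ arc
  ... | no ¬arc  = contradiction (filter-notAll arc? (allFin n) (lose (∈-allFin i) ¬arc))
                                 (<-irrefl (trans deg≡n (sym length-allFin)))

  full⇒inDegree≡n : FullInDegree h x → inDegree h x ≡ n
  full⇒inDegree≡n full =
    trans (cong length (filter-all arc? {allFin n} (All.tabulate λ {i} _ → arc⇐ (full i))))
          length-allFin

zeros : ∀ n → Config n
zeros n = replicate n false

ones : ∀ n → Config n
ones n = replicate n true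

e₀ : ∀ k → Config (suc k)
e₀ k = true ∷ zeros k

flipAt-zeros≢ones : ∀ {m} (i : Fin (suc (suc m))) → flipAt (zeros _) i ≢ ones _
flipAt-zeros≢ones Fin.zero    ()
flipAt-zeros≢ones (Fin.suc _) ()

lookup≡false⇒zeros : ∀ {k} (xs : Config k) → (∀ j → lookup xs j ≡ false) → xs ≡ zeros k
lookup≡false⇒zeros []       _        = refl
lookup≡false⇒zeros (a ∷ xs) all-false =
  cong₂ _∷_ (all-false Fin.zero) (lookup≡false⇒zeros xs (all-false ∘ Fin.suc))

module _ (m : ℕ) where
  private
    n : ℕ
    n = 3 + m

    h : F n
    h = collapse _≟c_ (ones n) (zeros n)

    module H = IsCollapse (collapse-isCollapse _≟c_ {ones n} {zeros n} (λ ()))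

    full-zeros : FullInDegree h (zeros n)
    full-zeros i = cong (λ v → lookup v i) (H.rest↦b _ (flipAt-zeros≢ones i) (flipAt≢ (zeros n) i))

    full-e₀ : FullInDegree h (e₀ (2 + m))
    full-e₀ Fin.zero    = cong (λ v → lookup v Fin.zero) H.b↦z
    full-e₀ (Fin.suc j) = cong (λ v → lookup v (Fin.suc j))
      (H.rest↦b (true ∷ flipAt (zeros (2 + m)) j) (flipAt-zeros≢ones j ∘ ∷-injectiveʳ) (λ ()))

  2≤cardΔ⁻-collapse-ones : 2 ≤ cardΔ⁻ (collapse _≟c_ (ones n) (zeros n))
  2≤cardΔ⁻-collapse-ones = 2≤count (λ x → inDegree h x ℕ.≟ n) {zeros n} {e₀ (2 + m)}
    (full⇒inDegree≡n h (zeros n) full-zeros) (full⇒inDegree≡n h (e₀ (2 + m)) full-e₀) (λ ())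

module _ (k : ℕ) where
  private
    h : F (suc k)
    h = collapse _≟c_ (e₀ k) (zeros (suc k))

    module H = IsCollapse (collapse-isCollapse _≟c_ {e₀ k} {zeros (suc k)} (λ ()))

    images-tail-zero : ∀ y j → lookup (h y) (Fin.suc j) ≡ false
    images-tail-zero y j with y ≟c e₀ k | y ≟c zeros (suc k)
    ... | yes _ | _     = lookup-replicate j false
    ... | no _  | yes _ = lookup-replicate j false
    ... | no _  | no _  = lookup-replicate j false

    full⇒tail-zeros : ∀ {a xs} → FullInDegree h (a ∷ xs) → xs ≡ zeros k
    full⇒tail-zeros {a} {xs} full = lookup≡false⇒zeros xs λ j →
      trans (sym (full (Fin.suc j))) (images-tail-zero (flipAt (a ∷ xs) (Fin.suc j)) j)

    full⇒e₀ : ∀ {x} → FullInDegree h x → x ≡ e₀ k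
    full⇒e₀ {a ∷ xs} full with full⇒tail-zeros full
    full⇒e₀ {true  ∷ _} full | refl = refl
    full⇒e₀ {false ∷ _} full | refl =
      contradiction (trans (sym (cong (λ v → lookup v Fin.zero) H.fixes-z)) (full Fin.zero)) λ ()

  cardΔ⁻-collapse-e₀≤1 : cardΔ⁻ (collapse _≟c_ (e₀ k) (zeros (suc k))) ≤ 1
  cardΔ⁻-collapse-e₀≤1 =
    count≤1 (λ x → inDegree h x ℕ.≟ suc k) (λ x deg≡n → full⇒e₀ (inDegree≡n⇒full h x deg≡n))

lemma8 : (n : ℕ) → n ≥ 3 → (f : F n) → NonConstant f →
    ¬ Contains2P1 f → UniquePeriodic f →
    cardΔ⁺ f ≡ 1 × Σ (F n) (λ h → h ∼ f × cardΔ⁻ h ≢ cardΔ⁻ f)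
lemma8 (suc (suc (suc m))) (s≤s (s≤s (s≤s _))) f nonConstant no2P1 uniquePeriodic
  with unique-periodic⇒collapse nonConstant no2P1 uniquePeriodic
... | _ , _ , f-collapse = cardΔ⁺-collapse f-collapse , other-Δ⁻ (cardΔ⁻ f ≤? 1)
  where
  collapse∼f : ∀ {z′ b′} → z′ ≢ b′ → collapse _≟c_ z′ b′ ∼ f
  collapse∼f z′≢b′ = collapse-conjugate _≟c_ f-collapse (collapse-isCollapse _≟c_ z′≢b′)

  other-Δ⁻ : Dec (cardΔ⁻ f ≤ 1) → Σ (F (3 + m)) λ h → h ∼ f × cardΔ⁻ h ≢ cardΔ⁻ f
  other-Δ⁻ (yes Δ⁻f≤1) = collapse _≟c_ (ones _) (zeros _) , collapse∼f (λ ()) ,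
    λ Δ⁻h≡Δ⁻f → ≤⇒≯ Δ⁻f≤1 (subst (2 ≤_) Δ⁻h≡Δ⁻f (2≤cardΔ⁻-collapse-ones m))
  other-Δ⁻ (no Δ⁻f≰1) = collapse _≟c_ (e₀ _) (zeros _) , collapse∼f (λ ()) ,
    λ Δ⁻h≡Δ⁻f → Δ⁻f≰1 (subst (_≤ 1) Δ⁻h≡Δ⁻f (cardΔ⁻-collapse-e₀≤1 (2 + m)))
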